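{- Let $R=\mathbb{Z}\times\mathbb{Z}$ with coordinatewise addition and multiplication $(a,b)\cdot(c,d)=(ac,ad+bc)$, and consider the template $(A,C,U)$ with $A=\mathbb{Z}^+\times\mathbb{N}$ and $C=U=\mathbb{N}^2$. Suppose $a_1,a_2\in\mathbb{Z}^+$ are coprime, $b\in\mathbb{N}$, and $\alpha_1=(a_1,0)$, $\alpha_2=(a_2,b)$. Then \[\mathrm{Frob}(\alpha_1,\alpha_2)=\bigl(\chi(a_1,a_2),\ \chi(a_1,a_2)+b(a_1-1)\bigr)+\mathbb{N}^2.\]
   Context: $\mathbb{N}$ is the set of nonnegative integers and $\mathbb{Z}^+=\mathbb{N}\setminus\{0\}$. $MN(\alpha_1,\alpha_2)=\{\lambda_1\alpha_1+\lambda_2\alpha_2:\lambda_1,\lambda_2\in\mathbb{N}^2\}$ (products in $R$), and $\mathrm{Frob}(\alpha_1,\alpha_2)=\{w\in R:w+\mathbb{N}^2\subseteq MN(\alpha_1,\alpha_2)\}$. For coprime positive integers $a_1,a_2$, $\chi(a_1,a_2)$ is the least $w\in\mathbb{N}$ with $w+\mathbb{N}\subseteq\{\lambda_1a_1+\lambda_2a_2:\lambda_1,\lambda_2\in\mathbb{N}\}$; classically $\chi(a_1,a_2)=(a_1-1)(a_2-1)$. -}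

module Defs where

open import Data.Nat as ℕ using (ℕ; _≤_)
open import Data.Integer as ℤ using (ℤ; +_)
open import Data.Product using (_×_; _,_; ∃; ∃-syntax)
open import Relation.Binary.PropositionalEquality using (_≡_)

R : Set
R = ℤ × ℤ

infixl 6 _⊕_
infixl 7 _⊗_

_⊕_ : R → R → R
(a , b) ⊕ (c , d) = (a ℤ.+ c , b ℤ.+ d)

_⊗_ : R → R → R
(a , b) ⊗ (c , d) = (a ℤ.* c , a ℤ.* d ℤ.+ b ℤ.* c)

ι : ℕ × ℕ → R
ι (p , q) = (+ p , + q)

InMN : R → R → R → Set
InMN α₁ α₂ x = ∃[ λ₁ ] ∃[ λ₂ ] (x ≡ ι λ₁ ⊗ α₁ ⊕ ι λ₂ ⊗ α₂)

InFrob : R → R → R → Set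
InFrob α₁ α₂ w = ∀ (u : ℕ × ℕ) → InMN α₁ α₂ (w ⊕ ι u)

InNS : ℕ → ℕ → ℕ → Set
InNS a₁ a₂ n = ∃[ l₁ ] ∃[ l₂ ] (n ≡ l₁ ℕ.* a₁ ℕ.+ l₂ ℕ.* a₂)

IsChi : ℕ → ℕ → ℕ → Set
IsChi a₁ a₂ c =
  (∀ n → InNS a₁ a₂ (c ℕ.+ n)) ×
  (∀ w → (∀ n → InNS a₁ a₂ (w ℕ.+ n)) → c ≤ w)

-- On ℕ² the product is (p , q) ⊗ (x , y) = (p x , p y + q x), so (X , Y) ∈ MN(α₁, α₂) iff
-- X = p₁ a₁ + p₂ a₂ and Y = q₁ a₁ + p₂ b + q₂ a₂ for some p₁ q₁ p₂ q₂ ∈ ℕ: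
-- the first coordinate ranges over ⟨a₁, a₂⟩, and the coefficient p₂ of a₂
-- there also contributes p₂ b to the second one.
-- Sufficiency: reducing p₂ modulo a₁ makes p₂ ≤ a₁ - 1, and the missing
-- b (a₁ - 1 - p₂) is absorbed into the free part q₁ a₁ + q₂ a₂ ≥ χ.
-- Necessity: if Y < χ + b (a₁ - 1), choose the first coordinate ≡ -a₂
-- (mod a₁); coprimality forces p₂ ≡ -1 (mod a₁), so p₂ b ≥ b (a₁ - 1)
-- and χ - 1 would lie in ⟨a₁, a₂⟩.
module Submission where

open import Defs
open import Data.Nat using (ℕ; zero; suc; _+_; _*_; _∸_; _≥_; _≤_; _<_; _≤?_; NonZero)
open import Data.Nat.Properties
  using (+-suc; +-assoc; *-comm; +-cancelʳ-≡; m+[n∸m]≡n; m≤n⇒∃[o]m+o≡n; ≤-pred; ≰⇒>; <⇒≱; n<1+n; suc-injective)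
  renaming (+-identityʳ to ℕ-+-identityʳ)
open import Data.Nat.Coprimality using (Coprime; coprime-divisor)
open import Data.Nat.Divisibility using (_∣_; divides; ∣m+n∣m⇒∣n; n∣m*n)
open import Data.Nat.DivMod using (_%_; _/_; m≡m%n+[m/n]*n; m%n<n)
open import Data.Nat.Tactic.RingSolver using (solve-∀)
open import Data.Integer as ℤ using (+_)
open import Data.Integer.Properties using (pos-+; pos-*; +-injective; +-identityʳ)
open import Data.Product using (_×_; _,_; proj₁; proj₂; ∃-syntax)
open import Data.Empty using (⊥-elim)
open import Relation.Nullary using (¬_; yes; no)
open import Relation.Binary.PropositionalEquality

ℕ² : Set
ℕ² = ℕ × ℕ

infixl 6 _⊕ᴺ_
infixl 7 _⊗ᴺ_

_⊕ᴺ_ : ℕ² → ℕ² → ℕ²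
(a , b) ⊕ᴺ (c , d) = (a + c , b + d)

_⊗ᴺ_ : ℕ² → ℕ² → ℕ²
(a , b) ⊗ᴺ (c , d) = (a * c , a * d + b * c)

⊕ᴺ-assoc : ∀ x y z → x ⊕ᴺ y ⊕ᴺ z ≡ x ⊕ᴺ (y ⊕ᴺ z)
⊕ᴺ-assoc (a , b) (c , d) (e , f) = cong₂ _,_ (+-assoc a c e) (+-assoc b d f)

ι-⊕ : ∀ x y → ι x ⊕ ι y ≡ ι (x ⊕ᴺ y)
ι-⊕ (a , b) (c , d) = sym (cong₂ _,_ (pos-+ a c) (pos-+ b d))

ι-⊗ : ∀ x y → ι x ⊗ ι y ≡ ι (x ⊗ᴺ y)
ι-⊗ (a , b) (c , d) = sym (cong₂ _,_ (pos-* a c)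
  (trans (pos-+ (a * d) (b * c)) (cong₂ ℤ._+_ (pos-* a d) (pos-* b c))))

ι-injective : ∀ {x y} → ι x ≡ ι y → x ≡ y
ι-injective eq = cong₂ _,_ (+-injective (cong proj₁ eq)) (+-injective (cong proj₂ eq))

⊕-ι-zero : ∀ w → w ⊕ ι (0 , 0) ≡ w
⊕-ι-zero (a , b) = cong₂ _,_ (+-identityʳ a) (+-identityʳ b)

InMNᴺ : ℕ² → ℕ² → ℕ² → Set
InMNᴺ α₁ α₂ x = ∃[ λ₁ ] ∃[ λ₂ ] (x ≡ λ₁ ⊗ᴺ α₁ ⊕ᴺ λ₂ ⊗ᴺ α₂)

InFrobᴺ : ℕ² → ℕ² → ℕ² → Set
InFrobᴺ α₁ α₂ w = ∀ u → InMNᴺ α₁ α₂ (w ⊕ᴺ u)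

ι-combination : ∀ λ₁ α₁ λ₂ α₂ → ι λ₁ ⊗ ι α₁ ⊕ ι λ₂ ⊗ ι α₂ ≡ ι (λ₁ ⊗ᴺ α₁ ⊕ᴺ λ₂ ⊗ᴺ α₂)
ι-combination λ₁ α₁ λ₂ α₂ = begin
  ι λ₁ ⊗ ι α₁ ⊕ ι λ₂ ⊗ ι α₂       ≡⟨ cong₂ _⊕_ (ι-⊗ λ₁ α₁) (ι-⊗ λ₂ α₂) ⟩
  ι (λ₁ ⊗ᴺ α₁) ⊕ ι (λ₂ ⊗ᴺ α₂)     ≡⟨ ι-⊕ (λ₁ ⊗ᴺ α₁) (λ₂ ⊗ᴺ α₂) ⟩
  ι (λ₁ ⊗ᴺ α₁ ⊕ᴺ λ₂ ⊗ᴺ α₂)        ∎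
  where open ≡-Reasoning

InMNᴺ⇒InMN : ∀ {α₁ α₂ x} → InMNᴺ α₁ α₂ x → InMN (ι α₁) (ι α₂) (ι x)
InMNᴺ⇒InMN {α₁} {α₂} (λ₁ , λ₂ , refl) = λ₁ , λ₂ , sym (ι-combination λ₁ α₁ λ₂ α₂)

InMN⇒InMNᴺ : ∀ {α₁ α₂ w} → InMN (ι α₁) (ι α₂) w → ∃[ x ] (w ≡ ι x × InMNᴺ α₁ α₂ x)
InMN⇒InMNᴺ {α₁} {α₂} (λ₁ , λ₂ , eq) =
  _ , trans eq (ι-combination λ₁ α₁ λ₂ α₂) , λ₁ , λ₂ , refl

InFrobᴺ⇒InFrob : ∀ {α₁ α₂ w} → InFrobᴺ α₁ α₂ w → InFrob (ι α₁) (ι α₂) (ι w)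
InFrobᴺ⇒InFrob {α₁} {α₂} {w} frob u =
  subst (InMN (ι α₁) (ι α₂)) (sym (ι-⊕ w u)) (InMNᴺ⇒InMN (frob u))

ι-InMN⇒InMNᴺ : ∀ {α₁ α₂ x} → InMN (ι α₁) (ι α₂) (ι x) → InMNᴺ α₁ α₂ x
ι-InMN⇒InMNᴺ {α₁} {α₂} mn with _ , ιx≡ιy , mnᴺ ← InMN⇒InMNᴺ {α₁} {α₂} mn =
  subst (InMNᴺ α₁ α₂) (sym (ι-injective ιx≡ιy)) mnᴺ

InFrob⇒InFrobᴺ : ∀ {α₁ α₂ w} → InFrob (ι α₁) (ι α₂) w → ∃[ W ] (w ≡ ι W × InFrobᴺ α₁ α₂ W)
InFrob⇒InFrobᴺ {α₁} {α₂} {w} frob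
  with W , w⊕0≡ιW , _ ← InMN⇒InMNᴺ {α₁} {α₂} (frob (0 , 0))
  = W , w≡ιW , λ u → ι-InMN⇒InMNᴺ (subst (InMN (ι α₁) (ι α₂)) (w⊕ιu≡ι[W⊕u] u) (frob u))
  where
  w≡ιW : w ≡ ι W
  w≡ιW = trans (sym (⊕-ι-zero w)) w⊕0≡ιW
  w⊕ιu≡ι[W⊕u] : ∀ u → w ⊕ ι u ≡ ι (W ⊕ᴺ u)
  w⊕ιu≡ι[W⊕u] u = trans (cong (_⊕ ι u) w≡ιW) (ι-⊕ W u)

InFrobᴺ-upward : ∀ {α₁ α₂} w v → InFrobᴺ α₁ α₂ w → InFrobᴺ α₁ α₂ (w ⊕ᴺ v)
InFrobᴺ-upward {α₁} {α₂} w v frob u = subst (InMNᴺ α₁ α₂) (sym (⊕ᴺ-assoc w v u)) (frob (v ⊕ᴺ u))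

InNS-reduced : ∀ {a₁ a₂ n} .{{_ : NonZero a₁}} → InNS a₁ a₂ n →
  ∃[ l₁ ] ∃[ r ] (r < a₁ × n ≡ l₁ * a₁ + r * a₂)
InNS-reduced {a₁} {a₂} (l₁ , l₂ , refl) =
  l₁ + l₂ / a₁ * a₂ , l₂ % a₁ , m%n<n l₂ a₁ ,
  trans (cong (λ l → l₁ * a₁ + l * a₂) (m≡m%n+[m/n]*n l₂ a₁)) (regroup l₁ (l₂ % a₁) (l₂ / a₁) a₁ a₂)
  where
  regroup : ∀ l r k a₁ a₂ → l * a₁ + (r + k * a₁) * a₂ ≡ (l + k * a₂) * a₁ + r * a₂
  regroup = solve-∀

IsChi-suc⇒¬InNS : ∀ {a₁ a₂ n} → IsChi a₁ a₂ (suc n) → ¬ InNS a₁ a₂ n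
IsChi-suc⇒¬InNS {a₁} {a₂} {n} (chi , least) ns = <⇒≱ (n<1+n n) (least n tail)
  where
  tail : ∀ k → InNS a₁ a₂ (n + k)
  tail zero    = subst (InNS a₁ a₂) (sym (ℕ-+-identityʳ n)) ns
  tail (suc k) = subst (InNS a₁ a₂) (sym (+-suc n k)) (chi k)

corner-InFrobᴺ : ∀ {a a₂ b c} → IsChi (suc a) a₂ c → InFrobᴺ (suc a , 0) (a₂ , b) (c , c + b * a)
corner-InFrobᴺ {a} {a₂} {b} {c} (chi , _) (s , t)
  with l₁ , r , r<a₁ , c+s≡ ← InNS-reduced (chi s)
  with d , r+d≡a ← m≤n⇒∃[o]m+o≡n (≤-pred r<a₁)
  with m₁ , m₂ , c+bd+t≡ ← chi (b * d + t)
  = (l₁ , m₁) , (r , m₂) , cong₂ _,_ c+s≡ snd-eq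
  where
  open ≡-Reasoning
  shuffle : ∀ c b r d t → c + b * (r + d) + t ≡ c + (b * d + t) + r * b
  shuffle = solve-∀
  regroup : ∀ l₁ m₁ a₁ m₂ a₂ r b → m₁ * a₁ + m₂ * a₂ + r * b ≡ l₁ * 0 + m₁ * a₁ + (r * b + m₂ * a₂)
  regroup = solve-∀
  snd-eq : c + b * a + t ≡ l₁ * 0 + m₁ * suc a + (r * b + m₂ * a₂)
  snd-eq = begin
    c + b * a + t                            ≡⟨ cong (λ x → c + b * x + t) (sym r+d≡a) ⟩
    c + b * (r + d) + t                      ≡⟨ shuffle c b r d t ⟩
    c + (b * d + t) + r * b                  ≡⟨ cong (_+ r * b) c+bd+t≡ ⟩
    m₁ * suc a + m₂ * a₂ + r * b             ≡⟨ regroup l₁ m₁ (suc a) m₂ a₂ r b ⟩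
    l₁ * 0 + m₁ * suc a + (r * b + m₂ * a₂)  ∎

InMNᴺ-fst : ∀ {a₁ b₁ a₂ b₂ X Y} → InMNᴺ (a₁ , b₁) (a₂ , b₂) (X , Y) → InNS a₁ a₂ X
InMNᴺ-fst ((p₁ , _) , (p₂ , _) , eq) = p₁ , p₂ , cong proj₁ eq

InFrobᴺ-fst-≥ : ∀ {a₁ b₁ a₂ b₂ c W₁ W₂} → IsChi a₁ a₂ c →
  InFrobᴺ (a₁ , b₁) (a₂ , b₂) (W₁ , W₂) → c ≤ W₁
InFrobᴺ-fst-≥ {W₁ = W₁} (_ , least) frob = least W₁ λ n → InMNᴺ-fst (frob (n , 0))

suc∣suc⇒≡ : ∀ {a p} → suc a ∣ suc p → ∃[ m ] (p ≡ a + m * suc a)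
suc∣suc⇒≡ (divides (suc m) eq) = m , suc-injective eq

coprime-coefficient : ∀ {a a₂ p₁ p₂} → Coprime (suc a) a₂ →
  suc a ∣ p₁ * suc a + suc p₂ * a₂ → ∃[ m ] (p₂ ≡ a + m * suc a)
coprime-coefficient {a} {a₂} {p₁} {p₂} coprime a₁∣ = suc∣suc⇒≡ (coprime-divisor coprime
  (subst (suc a ∣_) (*-comm (suc p₂) a₂) (∣m+n∣m⇒∣n a₁∣ (n∣m*n p₁))))

shifted-fst-divisible : ∀ a a₂ W₁ p₁ p₂ → W₁ + (a * a₂ + W₁ * a) ≡ p₁ * suc a + p₂ * a₂ →
  suc a ∣ p₁ * suc a + suc p₂ * a₂
shifted-fst-divisible a a₂ W₁ p₁ p₂ fst-eq = divides (W₁ + a₂) (begin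
  p₁ * suc a + suc p₂ * a₂     ≡⟨ add-a₂ p₁ (suc a) p₂ a₂ ⟩
  p₁ * suc a + p₂ * a₂ + a₂    ≡⟨ cong (_+ a₂) (sym fst-eq) ⟩
  W₁ + (a * a₂ + W₁ * a) + a₂  ≡⟨ factor W₁ a a₂ ⟩
  (W₁ + a₂) * suc a            ∎)
  where
  open ≡-Reasoning
  add-a₂ : ∀ p₁ a₁ p₂ a₂ → p₁ * a₁ + suc p₂ * a₂ ≡ p₁ * a₁ + p₂ * a₂ + a₂
  add-a₂ = solve-∀
  factor : ∀ W₁ a a₂ → W₁ + (a * a₂ + W₁ * a) + a₂ ≡ (W₁ + a₂) * suc a
  factor = solve-∀

InFrobᴺ-snd-≥ : ∀ {a a₂ b c W₁ W₂} → Coprime (suc a) a₂ → IsChi (suc a) a₂ c →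
  InFrobᴺ (suc a , 0) (a₂ , b) (W₁ , W₂) → c + b * a ≤ W₂
InFrobᴺ-snd-≥ {a} {a₂} {b} {c} {W₁} {W₂} coprime chi frob with c + b * a ≤? W₂
... | yes bound = bound
... | no ¬bound
  with e , 1+W₂+e≡c+ba ← m≤n⇒∃[o]m+o≡n (≰⇒> ¬bound)
  -- u₁ is chosen so that W₁ + u₁ = (W₁ + a₂) a₁ - a₂ ≡ -a₂ (mod a₁)
  with (p₁ , q₁) , (p₂ , q₂) , eq ← frob (a * a₂ + W₁ * a , e)
  with m , refl ← coprime-coefficient {p₁ = p₁} {p₂} coprime
                    (shifted-fst-divisible a a₂ W₁ p₁ p₂ (cong proj₁ eq))
  = ⊥-elim (IsChi-suc⇒¬InNS (subst (IsChi (suc a) a₂) c≡1+ns chi) (q₁ + m * b , q₂ , refl))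
  where
  open ≡-Reasoning
  regroup : ∀ p₁ q₁ a m b q₂ a₂ →
    suc (p₁ * 0 + q₁ * suc a + ((a + m * suc a) * b + q₂ * a₂)) ≡ suc ((q₁ + m * b) * suc a + q₂ * a₂) + b * a
  regroup = solve-∀
  c≡1+ns : c ≡ suc ((q₁ + m * b) * suc a + q₂ * a₂)
  c≡1+ns = +-cancelʳ-≡ (b * a) c _ (begin
    c + b * a                                                    ≡⟨ sym 1+W₂+e≡c+ba ⟩
    suc (W₂ + e)                                                 ≡⟨ cong suc (cong proj₂ eq) ⟩
    suc (p₁ * 0 + q₁ * suc a + ((a + m * suc a) * b + q₂ * a₂))  ≡⟨ regroup p₁ q₁ a m b q₂ a₂ ⟩
    suc ((q₁ + m * b) * suc a + q₂ * a₂) + b * a                 ∎)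

≤⇒≡⊕ᴺ∸ : ∀ {V₁ V₂ W₁ W₂} → V₁ ≤ W₁ → V₂ ≤ W₂ → (W₁ , W₂) ≡ (V₁ , V₂) ⊕ᴺ (W₁ ∸ V₁ , W₂ ∸ V₂)
≤⇒≡⊕ᴺ∸ V₁≤W₁ V₂≤W₂ = sym (cong₂ _,_ (m+[n∸m]≡n V₁≤W₁) (m+[n∸m]≡n V₂≤W₂))

proposition4p5 : (a₁ a₂ b c : ℕ) → a₁ ≥ 1 → a₂ ≥ 1 → Coprime a₁ a₂ → IsChi a₁ a₂ c →
    (w : R) →
      (InFrob (+ a₁ , + 0) (+ a₂ , + b) w → ∃[ u ] (w ≡ ι (c , c + b * (a₁ ∸ 1)) ⊕ ι u)) ×
      (∃[ u ] (w ≡ ι (c , c + b * (a₁ ∸ 1)) ⊕ ι u) → InFrob (+ a₁ , + 0) (+ a₂ , + b) w)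
proposition4p5 zero _ _ _ () _ _ _ _
proposition4p5 (suc a) a₂ b c _ _ coprime chi w = frob⇒above , above⇒frob
  where
  corner : ℕ²
  corner = (c , c + b * a)
  frob⇒above : InFrob (ι (suc a , 0)) (ι (a₂ , b)) w → ∃[ u ] (w ≡ ι corner ⊕ ι u)
  frob⇒above frob with _ , w≡ιW , frobᴺ ← InFrob⇒InFrobᴺ frob =
    _ , trans w≡ιW (trans (cong ι (≤⇒≡⊕ᴺ∸ (InFrobᴺ-fst-≥ chi frobᴺ) (InFrobᴺ-snd-≥ coprime chi frobᴺ)))
                          (sym (ι-⊕ corner _)))
  above⇒frob : ∃[ u ] (w ≡ ι corner ⊕ ι u) → InFrob (ι (suc a , 0)) (ι (a₂ , b)) w
  above⇒frob (u , w≡) = subst (InFrob (ι (suc a , 0)) (ι (a₂ , b))) (sym (trans w≡ (ι-⊕ corner u)))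
    (InFrobᴺ⇒InFrob (InFrobᴺ-upward corner u (corner-InFrobᴺ chi)))
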